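{- Consider the following two-player game on a path with $n\ge 1$ edges. Players 1 and 2 alternate turns, Player 1 first; on a turn the player must, if possible, direct one currently undirected edge, subject to the rule that no internal vertex of the path may become a sink or a source (the two end vertices are exempt from this rule). The player who makes the last legal move wins. Then Player 1 has a winning strategy if $n$ is odd, and Player 2 has a winning strategy if $n$ is even.
   Context: A vertex is a sink if all edges incident to it are directed into it, and a source if all edges incident to it are directed out of it. (This is the Game of Cycles played on a path: since a path has no cycles, the winner is the player making the last legal move.) -}

module Defs where

open import Data.Nat using (ℕ; suc)
open import Data.Fin using (Fin; toℕ)
open import Data.Maybe using (Maybe; just; nothing)
open import Data.Vec using (Vec; lookup; replicate; _[_]≔_)
open import Data.Product using (_×_)
open import Relation.Nullary using (¬_)
open import Relation.Binary.PropositionalEquality using (_≡_)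

-- Path with n edges: vertices 0,1,…,n; edge i (i : Fin n) joins vertex i and vertex i+1.
-- An edge is either undirected (nothing) or directed:
--   fwd : from vertex i to vertex i+1,   bwd : from vertex i+1 to vertex i.
data Dir : Set where
  fwd bwd : Dir

Board : ℕ → Set
Board n = Vec (Maybe Dir) n

start : (n : ℕ) → Board n
start n = replicate n nothing

-- The internal vertices are exactly the vertices toℕ i + 1 lying between two
-- consecutive edges i and j (toℕ j ≡ suc (toℕ i)); both of its incident edges are i and j.
SinkAt : ∀ {n} → Board n → Fin n → Fin n → Set
SinkAt b i j = (lookup b i ≡ just fwd) × (lookup b j ≡ just bwd)

SourceAt : ∀ {n} → Board n → Fin n → Fin n → Set
SourceAt b i j = (lookup b i ≡ just bwd) × (lookup b j ≡ just fwd)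

Legal : ∀ {n} → Board n → Set
Legal {n} b = (i j : Fin n) → toℕ j ≡ suc (toℕ i) → ¬ SinkAt b i j × ¬ SourceAt b i j

play : ∀ {n} → Board n → Fin n → Dir → Board n
play b i d = b [ i ]≔ just d

-- Normal play (last legal move wins), positions from the viewpoint of the player to move.
-- Loses b : the player NOT to move (the opponent) has a winning strategy from b,
--           i.e. every legal move leads to a position winning for the opponent
--           (in particular, having no legal move means losing).
mutual
  data Wins {n : ℕ} (b : Board n) : Set where
    win : (i : Fin n) → lookup b i ≡ nothing → (d : Dir) →
          Legal (play b i d) → Loses (play b i d) → Wins b

  data Loses {n : ℕ} (b : Board n) : Set where
    lose : ((i : Fin n) → lookup b i ≡ nothing → (d : Dir) →
            Legal (play b i d) → Wins (play b i d)) → Loses b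

-- The second player to move wins by answering every move on edge i with the same
-- direction on the opposite edge n-1-i, keeping the board invariant under the half-turn
-- of the path. The half-turn exchanges sinks and sources, so the answer is legal whenever
-- the opponent's move was: near the move the board agrees with the opponent's (legal)
-- position, near the answer with its (legal) half-turn, and the two freshly directed
-- edges, if adjacent, point the same way. This needs the centre edge to be directed: for
-- even n there is none, so Player 2 mirrors; for odd n Player 1 first directs the centre
-- edge and then mirrors.
module Submission where

open import Defs
open import Data.Nat using (ℕ; zero; suc; _+_; _*_; _<_; _≤_; _%_; _/_; s≤s)
open import Data.Nat.Properties
  using (+-suc; +-cancelʳ-≡; *-cancelʳ-≡; suc-injective; 1+n≢n; m≤m*n; m∸n+n≡m; ≤-reflexive; ≤-trans; n≤1+n)
open import Data.Nat.DivMod using (m≡m%n+[m/n]*n; [m+kn]%n≡m%n)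
open import Data.Nat.Induction using (<-wellFounded)
open import Data.Fin using (Fin; toℕ; opposite; fromℕ<)
open import Data.Fin.Properties using (opposite-prop; opposite-involutive; toℕ-injective; toℕ<n; toℕ-fromℕ<; _≟_)
open import Data.Maybe using (just; nothing)
open import Data.Vec using ([]; _∷_; lookup)
open import Data.Vec.Properties using (lookup∘update; lookup∘update′; lookup-replicate; []≔-commutes)
open import Data.Product using (_×_; _,_)
open import Function using (_∘_)
open import Induction.WellFounded using (Acc; acc)
open import Relation.Nullary using (¬_; yes; no)
open import Relation.Binary.PropositionalEquality

private variable
  n : ℕ

m+1+m≡1+m*2 : ∀ m → m + suc m ≡ suc (m * 2)
m+1+m≡1+m*2 zero    = refl
m+1+m≡1+m*2 (suc m) = cong suc (trans (+-suc m (suc m)) (cong suc (m+1+m≡1+m*2 m)))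

opposite-+ : (j : Fin n) → toℕ (opposite j) + suc (toℕ j) ≡ n
opposite-+ j = trans (cong (_+ suc (toℕ j)) (opposite-prop j)) (m∸n+n≡m (toℕ<n j))

opposite-injective : {i j : Fin n} → opposite i ≡ opposite j → i ≡ j
opposite-injective {i = i} {j} eq =
  trans (sym (opposite-involutive i)) (trans (cong opposite eq) (opposite-involutive j))

opposite-adjacent : {p q : Fin n} → toℕ q ≡ suc (toℕ p) → toℕ (opposite p) ≡ suc (toℕ (opposite q))
opposite-adjacent {p = p} {q} adj = +-cancelʳ-≡ (suc (toℕ p)) _ _ (begin
  toℕ (opposite p) + suc (toℕ p)        ≡⟨ opposite-+ p ⟩
  _                                     ≡⟨ opposite-+ q ⟨
  toℕ (opposite q) + suc (toℕ q)        ≡⟨ cong (λ x → toℕ (opposite q) + suc x) adj ⟩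
  toℕ (opposite q) + suc (suc (toℕ p))  ≡⟨ +-suc (toℕ (opposite q)) (suc (toℕ p)) ⟩
  suc (toℕ (opposite q)) + suc (toℕ p)  ∎)
  where open ≡-Reasoning

opposite-fixed⇒ : {j : Fin n} → opposite j ≡ j → n ≡ suc (toℕ j * 2)
opposite-fixed⇒ {j = j} fixed =
  trans (sym (opposite-+ j)) (trans (cong (λ x → toℕ x + suc (toℕ j)) fixed) (m+1+m≡1+m*2 (toℕ j)))

opposite-fixed⇐ : {j : Fin n} → n ≡ suc (toℕ j * 2) → opposite j ≡ j
opposite-fixed⇐ {j = j} n≡ = toℕ-injective (+-cancelʳ-≡ (suc (toℕ j)) _ _
  (trans (opposite-+ j) (trans n≡ (sym (m+1+m≡1+m*2 (toℕ j))))))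

NoSinkNorSource : Board n → Fin n → Fin n → Set
NoSinkNorSource b p q = ¬ SinkAt b p q × ¬ SourceAt b p q

noSinkNorSource-cong : (b b′ : Board n) {p q : Fin n} →
  lookup b p ≡ lookup b′ p → lookup b q ≡ lookup b′ q →
  NoSinkNorSource b p q → NoSinkNorSource b′ p q
noSinkNorSource-cong _ _ bp bq (¬sink , ¬source) =
  (λ (fp , bq′) → ¬sink (trans bp fp , trans bq bq′)) ,
  (λ (bp′ , fq) → ¬source (trans bp bp′ , trans bq fq))

noSinkNorSource-parallel : (b : Board n) {p q : Fin n} → lookup b p ≡ lookup b q → NoSinkNorSource b p q
noSinkNorSource-parallel _ p≡q = (λ (fp , bq) → fwd≢bwd (trans (sym fp) (trans p≡q bq)))
                             , (λ (bp , fq) → fwd≢bwd (trans (sym fq) (trans (sym p≡q) bp)))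
  where
  fwd≢bwd : just fwd ≢ just bwd
  fwd≢bwd ()

-- The half-turn maps edge j to opposite j and keeps fwd and bwd (a reflection would swap them).
record Mirrored (b b′ : Board n) : Set where
  constructor mirrored
  field mirrors : ∀ j → lookup b′ (opposite j) ≡ lookup b j

open Mirrored

Symmetric : Board n → Set
Symmetric b = Mirrored b b

CentreDirected : Board n → Set
CentreDirected b = ∀ j → lookup b j ≡ nothing → opposite j ≢ j

mirrored-lookup : {b b′ : Board n} → Mirrored b b′ → ∀ j → lookup b′ j ≡ lookup b (opposite j)
mirrored-lookup {b′ = b′} m j = trans (cong (lookup b′) (sym (opposite-involutive j))) (mirrors m (opposite j))

mirrored-play : {b b′ : Board n} → Mirrored b b′ → ∀ i d → Mirrored (play b i d) (play b′ (opposite i) d)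
mirrored-play {b = b} {b′} m i d = mirrored reflect
  where
  reflect : ∀ j → lookup (play b′ (opposite i) d) (opposite j) ≡ lookup (play b i d) j
  reflect j with i ≟ j
  ... | yes refl = trans (lookup∘update (opposite i) b′ (just d)) (sym (lookup∘update i b (just d)))
  ... | no i≢j   = trans (lookup∘update′ (i≢j ∘ opposite-injective ∘ sym) b′ (just d))
                         (trans (mirrors m j) (sym (lookup∘update′ (i≢j ∘ sym) b (just d))))

-- A sink of b at p, q is a source of its half-turn at opposite q, opposite p, and conversely.
mirrored-legal : {b b′ : Board n} → Mirrored b b′ → Legal b → Legal b′
mirrored-legal {b = b} {b′} m legal p q adj with legal (opposite q) (opposite p) (opposite-adjacent adj)
... | ¬sink , ¬source = (λ (fp , bq) → ¬source (trans (sym at-q) bq , trans (sym at-p) fp))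
                      , (λ (bp , fq) → ¬sink (trans (sym at-q) fq , trans (sym at-p) bp))
  where
  at-p : lookup b′ p ≡ lookup b (opposite p)
  at-p = mirrored-lookup m p
  at-q : lookup b′ q ≡ lookup b (opposite q)
  at-q = mirrored-lookup m q

play-undirected : (b : Board n) (i j : Fin n) (d : Dir) → lookup (play b i d) j ≡ nothing → lookup b j ≡ nothing
play-undirected b i j d free with i ≟ j
... | yes refl with () ← trans (sym (lookup∘update i b (just d))) free
... | no i≢j   = trans (sym (lookup∘update′ (i≢j ∘ sym) b (just d))) free

#undirected : Board n → ℕ
#undirected []             = 0
#undirected (nothing ∷ b)  = suc (#undirected b)
#undirected (just _ ∷ b)   = #undirected b

#undirected-play : (b : Board n) (i : Fin n) (d : Dir) → lookup b i ≡ nothing →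
  suc (#undirected (play b i d)) ≡ #undirected b
#undirected-play (nothing ∷ b) Fin.zero    d free = refl
#undirected-play (nothing ∷ b) (Fin.suc i) d free = cong suc (#undirected-play b i d free)
#undirected-play (just _ ∷ b)  (Fin.suc i) d free = #undirected-play b i d free

module MirrorReply {b : Board n} (symmetric : Symmetric b) (centre : CentreDirected b)
                   (i : Fin n) (free : lookup b i ≡ nothing) (d : Dir) where

  move mirror reply : Board n
  move   = play b i d
  mirror = play b (opposite i) d
  reply  = play move (opposite i) d

  i≢opposite-i : i ≢ opposite i
  i≢opposite-i = centre i free ∘ sym

  reply-free : lookup move (opposite i) ≡ nothing
  reply-free = trans (lookup∘update′ (i≢opposite-i ∘ sym) b (just d)) (trans (mirrors symmetric i) free)

  reply≡ : reply ≡ play mirror i d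
  reply≡ = []≔-commutes b i (opposite i) i≢opposite-i

  reply-i : lookup reply i ≡ just d
  reply-i = trans (cong (λ c → lookup c i) reply≡) (lookup∘update i mirror (just d))

  reply-opposite-i : lookup reply (opposite i) ≡ just d
  reply-opposite-i = lookup∘update (opposite i) move (just d)

  move≈reply : ∀ {x} → opposite i ≢ x → lookup move x ≡ lookup reply x
  move≈reply ne = sym (lookup∘update′ (ne ∘ sym) move (just d))

  mirror≈reply : ∀ {x} → i ≢ x → lookup mirror x ≡ lookup reply x
  mirror≈reply {x} ne = sym (trans (cong (λ c → lookup c x) reply≡) (lookup∘update′ (ne ∘ sym) mirror (just d)))

  mirror-legal : Legal move → Legal mirror
  mirror-legal = mirrored-legal (mirrored-play symmetric i d)

  reply-legal : Legal move → Legal reply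
  reply-legal legal p q adj with opposite i ≟ p | opposite i ≟ q
  ... | no opposite-i≢p | no opposite-i≢q =
    noSinkNorSource-cong move reply (move≈reply opposite-i≢p) (move≈reply opposite-i≢q) (legal p q adj)
  ... | yes refl | _ with i ≟ q
  ...   | yes refl = noSinkNorSource-parallel reply (trans reply-opposite-i (sym reply-i))
  ...   | no i≢q   =
    noSinkNorSource-cong mirror reply (mirror≈reply i≢opposite-i) (mirror≈reply i≢q) (mirror-legal legal p q adj)
  reply-legal legal p q adj | no _ | yes refl with i ≟ p
  ...   | yes refl = noSinkNorSource-parallel reply (trans reply-i (sym reply-opposite-i))
  ...   | no i≢p   =
    noSinkNorSource-cong mirror reply (mirror≈reply i≢p) (mirror≈reply i≢opposite-i) (mirror-legal legal p q adj)

  reply-symmetric : Symmetric reply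
  reply-symmetric = subst (Mirrored reply) (sym reply≡)
    (subst (λ j → Mirrored reply (play mirror j d)) (opposite-involutive i)
      (mirrored-play (mirrored-play symmetric i d) (opposite i) d))

  reply-centreDirected : CentreDirected reply
  reply-centreDirected j = centre j ∘ play-undirected b i j d ∘ play-undirected move (opposite i) j d

  reply-decreases : #undirected reply < #undirected b
  reply-decreases = ≤-trans (n≤1+n _) (≤-reflexive (begin
    suc (suc (#undirected reply))  ≡⟨ cong suc (#undirected-play move (opposite i) d reply-free) ⟩
    suc (#undirected move)         ≡⟨ #undirected-play b i d free ⟩
    #undirected b                  ∎))
    where open ≡-Reasoning

mirror-strategy : (b : Board n) → Acc _<_ (#undirected b) → Symmetric b → CentreDirected b → Loses b
mirror-strategy b (acc smaller) symmetric centre = lose answer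
  where
  answer : ∀ i → lookup b i ≡ nothing → ∀ d → Legal (play b i d) → Wins (play b i d)
  answer i free d legal = win (opposite i) reply-free d (reply-legal legal)
    (mirror-strategy reply (smaller reply-decreases) reply-symmetric reply-centreDirected)
    where open MirrorReply symmetric centre i free d

symmetric-loses : {b : Board n} → Symmetric b → CentreDirected b → Loses b
symmetric-loses {b = b} = mirror-strategy b (<-wellFounded _)

start-symmetric : Symmetric (start n)
start-symmetric = mirrored λ j → trans (lookup-replicate (opposite j) nothing) (sym (lookup-replicate j nothing))

play-start-directed : (m j : Fin n) (d : Dir) {d′ : Dir} → lookup (play (start n) m d) j ≡ just d′ → j ≡ m
play-start-directed {n} m j d directed with m ≟ j
... | yes refl = refl
... | no m≢j with () ← trans (sym (lookup-replicate j nothing))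
                             (trans (sym (lookup∘update′ (m≢j ∘ sym) (start n) (just d))) directed)

play-start-legal : (m : Fin n) (d : Dir) → Legal (play (start n) m d)
play-start-legal {n} m d p q adj = (λ (fp , bq) → p≢q (trans (at-m p fp) (sym (at-m q bq))))
                             , (λ (bp , fq) → p≢q (trans (at-m p bp) (sym (at-m q fq))))
  where
  at-m : ∀ j {d′} → lookup (play (start n) m d) j ≡ just d′ → j ≡ m
  at-m j = play-start-directed m j d

  p≢q : p ≢ q
  p≢q p≡q = 1+n≢n (trans (sym adj) (cong toℕ (sym p≡q)))

even-loses : n % 2 ≡ 0 → Loses (start n)
even-loses {n} even = symmetric-loses start-symmetric λ j _ fixed → 0≢1 (begin
  0                    ≡⟨ even ⟨
  n % 2                ≡⟨ cong (_% 2) (opposite-fixed⇒ fixed) ⟩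
  suc (toℕ j * 2) % 2  ≡⟨ [m+kn]%n≡m%n 1 (toℕ j) 2 ⟩
  1                    ∎)
  where
  open ≡-Reasoning
  0≢1 : 0 ≢ 1
  0≢1 ()

odd-wins : n % 2 ≡ 1 → Wins (start n)
odd-wins {n} odd = win centre (lookup-replicate centre nothing) fwd (play-start-legal centre fwd)
  (symmetric-loses first-symmetric first-centreDirected)
  where
  n≡ : n ≡ suc (n / 2 * 2)
  n≡ = trans (m≡m%n+[m/n]*n n 2) (cong (_+ n / 2 * 2) odd)

  half<n : n / 2 < n
  half<n = subst (n / 2 <_) (sym n≡) (s≤s (m≤m*n (n / 2) 2))

  centre : Fin n
  centre = fromℕ< half<n

  first : Board n
  first = play (start n) centre fwd

  centre-fixed : opposite centre ≡ centre
  centre-fixed = opposite-fixed⇐ (trans n≡ (cong (λ k → suc (k * 2)) (sym (toℕ-fromℕ< half<n))))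

  fixed⇒centre : ∀ {j} → opposite j ≡ j → j ≡ centre
  fixed⇒centre {j} fixed = toℕ-injective (trans
    (*-cancelʳ-≡ (toℕ j) (n / 2) 2 (suc-injective (trans (sym (opposite-fixed⇒ fixed)) n≡))) (sym (toℕ-fromℕ< half<n)))

  first-symmetric : Symmetric first
  first-symmetric = subst (λ c → Mirrored first (play (start n) c fwd)) centre-fixed
    (mirrored-play start-symmetric centre fwd)

  first-centreDirected : CentreDirected first
  first-centreDirected j free fixed with refl ← fixed⇒centre fixed
    with () ← trans (sym (lookup∘update centre (start n) (just fwd))) free

theorem1 : (n : ℕ) → 1 ≤ n →
    (n % 2 ≡ 1 → Wins (start n)) × (n % 2 ≡ 0 → Loses (start n))
theorem1 n _ = odd-wins , even-loses
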